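{- Let $m,n\ge 3$ be integers such that $q=2mn+1$ is a prime power and there exist two distinct odd primes $p$ and $p'$ with $p\mid m$ and $p'\mid n$. Then there exists a rank-one Heffter array H$(m,n)$ over $\mathbb{F}_q$.
   Context: A half-set of an additive group $G$ of odd order $2\ell+1$ is an $\ell$-subset $L$ with $L\cup -L=G\setminus\{0\}$. A Heffter array H$(m,n)$ over $\mathbb{F}_q$ (with $q=2mn+1$) is an $m\times n$ matrix over $\mathbb{F}_q$ whose entries form a half-set of the additive group of $\mathbb{F}_q$ and whose every row and column sums to $0$; it is rank-one if it has rank $1$ as a matrix over $\mathbb{F}_q$. (In the paper, a pair $(m,n)$ with $m,n>2$, $2mn+1$ a prime power and such primes $p,p'$ is called agreeable.) -}

module Defs where

open import Level using (Level; _⊔_)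
open import Data.Nat using (ℕ; zero; suc; _^_; _≤_)
open import Data.Nat.Primality using (Prime)
open import Data.Fin using (Fin; zero; suc)
open import Data.Product using (Σ; _×_; _,_; ∃)
open import Data.Sum using (_⊎_)
open import Relation.Nullary using (¬_)
open import Relation.Binary.PropositionalEquality using (_≡_)
import Relation.Binary.PropositionalEquality as ≡
open import Algebra.Bundles using (CommutativeRing)
open import Function.Bundles using (Inverse)

IsPrimePower : ℕ → Set
IsPrimePower q = Σ ℕ λ p → Σ ℕ λ k → Prime p × (1 ≤ k) × (q ≡ p ^ k)

record IsField {c ℓ : Level} (R : CommutativeRing c ℓ) : Set (c ⊔ ℓ) where
  open CommutativeRing R using (Carrier; _≈_; _+_; _*_; -_; 0#; 1#)
  field
    1≉0     : ¬ (1# ≈ 0#)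
    inverse : ∀ x → ¬ (x ≈ 0#) → Σ Carrier λ y → (x * y) ≈ 1#

record IsFiniteFieldOfOrder {c ℓ : Level} (R : CommutativeRing c ℓ) (q : ℕ) : Set (c ⊔ ℓ) where
  field
    isField     : IsField R
    cardinality : Inverse (CommutativeRing.setoid R) (≡.setoid (Fin q))

module _ {c ℓ : Level} (R : CommutativeRing c ℓ) where
  open CommutativeRing R using (Carrier; _≈_; _+_; _*_; -_; 0#; 1#)

  ∑ : (k : ℕ) → (Fin k → Carrier) → Carrier
  ∑ zero    f = 0#
  ∑ (suc k) f = f zero + ∑ k (λ i → f (suc i))

  Matrix : ℕ → ℕ → Set c
  Matrix m n = Fin m → Fin n → Carrier

  -- the mn entries of A form a half-set of (Carrier,+):
  -- they are pairwise distinct (so form an mn-subset L, mn = (q-1)/2), and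
  -- L ∪ -L = Carrier ∖ {0}.
  EntriesHalfSet : {m n : ℕ} → Matrix m n → Set (c ⊔ ℓ)
  EntriesHalfSet {m} {n} A =
    (∀ i j i′ j′ → A i j ≈ A i′ j′ → (i ≡ i′) × (j ≡ j′))
    × (∀ i j → ¬ (A i j ≈ 0#))
    × (∀ x → ¬ (x ≈ 0#) → Σ (Fin m) λ i → Σ (Fin n) λ j → (x ≈ A i j) ⊎ (x ≈ - A i j))

  IsHeffter : {m n : ℕ} → Matrix m n → Set (c ⊔ ℓ)
  IsHeffter {m} {n} A =
    EntriesHalfSet A
    × (∀ i → ∑ n (λ j → A i j) ≈ 0#)
    × (∀ j → ∑ m (λ i → A i j) ≈ 0#)

  RankOne : {m n : ℕ} → Matrix m n → Set (c ⊔ ℓ)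
  RankOne {m} {n} A =
    (Σ (Fin m) λ i → Σ (Fin n) λ j → ¬ (A i j ≈ 0#))
    × (Σ (Fin m → Carrier) λ u → Σ (Fin n → Carrier) λ v → ∀ i j → A i j ≈ (u i * v j))

module Submission where

-- Let g be a primitive root of F, so g has order 2mn and g ^ (mn) = -1, and write m = m′p, n = n′p′.
-- Index the rows by pairs (a , k) ∈ [m′] × [p] and the columns by (b , l) ∈ [n′] × [p′], and take the
-- outer product of u = g ^ a α ^ k and v = (g ^ m′) ^ b β ^ l, where α = g ^ (2p′m′n′) and β = g ^ (2pm′n′)
-- have orders p and p′. Each column sum then carries the factor 1 + α + ⋯ + α ^ (p - 1) = 0 and each row
-- sum the factor 1 + β + ⋯ + β ^ (p′ - 1) = 0. The entry at (a , k , b , l) is g ^ E with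
-- E = a + m′b + m′n′(2p′k + 2pl), and as ±g ^ E = g ^ (E + ε mn), the entries form a half-set because E
-- determines the indices modulo mn = m′n′pp′: the low part a + m′b < m′n′ by mixed-radix uniqueness, and
-- k, l from 2p′k + 2pl modulo pp′ because 2p′ is invertible modulo p and 2p modulo p′ (p, p′ odd and
-- distinct). A primitive root exists by the classical argument: every order divides a maximal order e,
-- so all nonzero elements are roots of y ^ e - 1, and a polynomial has no more roots than its degree.

open import Algebra.Bundles using (Monoid; CommutativeSemiring; CommutativeRing)
open import Data.Nat as ℕ using (ℕ; zero; suc)
import Data.Nat.Properties as ℕ
open import Data.Nat.Primality using (Prime)
open import Data.Fin using (Fin; zero; suc; toℕ; fromℕ<)
open import Data.Product using (_×_; _,_; ∃; ∃-syntax; ∃₂; proj₁; proj₂)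
open import Data.Sum using (_⊎_; inj₁; inj₂)
open import Function using (_∘_)
open import Function.Bundles using (Inverse)
open import Relation.Binary.PropositionalEquality as ≡ using (_≡_; _≢_)
open import Defs

module NatArithmetic where

  open import Data.Nat
  open import Data.Nat.Properties
  open import Data.Nat.DivMod using (_%_; [m+kn]%n≡m%n; m<n⇒m%n≡m)
  open import Data.Nat.Divisibility
  open import Data.Nat.Primality
  open import Data.Nat.Coprimality using (Coprime; coprime-divisor)
  import Data.Nat.Coprimality as Coprime
  open import Data.Nat.Induction using (<-rec)
  open import Data.Nat.Primality.Factorisation using (factorise)
  open import Data.Nat.ListAction using (product)
  open import Data.Nat.Solver using (module +-*-Solver)
  open import Data.List using ([]; _∷_)
  open import Data.List.Relation.Unary.All using (_∷_)
  open import Data.Fin using (remQuot; combine)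
  open import Data.Fin.Properties using (combine-remQuot)
  open import Data.Product using (uncurry)
  open import Relation.Nullary using (yes; no; contradiction)
  open import Relation.Binary.PropositionalEquality
  open +-*-Solver

  0<*⇒0<ˡ : ∀ {m n} → 0 < m * n → 0 < m
  0<*⇒0<ˡ {suc _} _ = z<s

  0<*⇒0<ʳ : ∀ {m n} → 0 < m * n → 0 < n
  0<*⇒0<ʳ {m} {n} = 0<*⇒0<ˡ ∘ subst (0 <_) (*-comm m n)

  prime⇒2≤ : ∀ {p} → Prime p → 2 ≤ p
  prime⇒2≤ {p} pp = nonTrivial⇒n>1 p {{prime⇒nonTrivial pp}}

  prime∤prime : ∀ {p q} → Prime p → Prime q → p ≢ q → p ∤ q
  prime∤prime pp pq p≢q p∣q with prime⇒irreducible pq p∣q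
  ... | inj₁ refl = ¬prime[1] pp
  ... | inj₂ p≡q  = p≢q p≡q

  prime∤2*prime : ∀ {p q} → Prime p → Prime q → p ≢ 2 → p ≢ q → p ∤ 2 * q
  prime∤2*prime pp pq p≢2 p≢q p∣2q with euclidsLemma 2 _ pp p∣2q
  ... | inj₁ p∣2 = prime∤prime pp prime[2] p≢2 p∣2
  ... | inj₂ p∣q = prime∤prime pp pq p≢q p∣q

  divMod-unique : ∀ {T u u′ w w′} → u < T → u′ < T →
                  u + T * w ≡ u′ + T * w′ → u ≡ u′ × w ≡ w′
  divMod-unique {T} {u} {u′} {w} {w′} u<T u′<T eq = u≡u′ , w≡w′
    where
    instance
      T≢0 : NonZero T
      T≢0 = >-nonZero (≤-<-trans z≤n u<T)
    u≡u′ : u ≡ u′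
    u≡u′ = begin
      u                 ≡⟨ m<n⇒m%n≡m u<T ⟨
      u % T             ≡⟨ [m+kn]%n≡m%n u w T ⟨
      (u + w * T) % T   ≡⟨ cong (λ t → (u + t) % T) (*-comm w T) ⟩
      (u + T * w) % T   ≡⟨ cong (_% T) eq ⟩
      (u′ + T * w′) % T ≡⟨ cong (λ t → (u′ + t) % T) (*-comm T w′) ⟩
      (u′ + w′ * T) % T ≡⟨ [m+kn]%n≡m%n u′ w′ T ⟩
      u′ % T            ≡⟨ m<n⇒m%n≡m u′<T ⟩
      u′                ∎
      where open ≡-Reasoning
    w≡w′ : w ≡ w′
    w≡w′ = *-cancelˡ-≡ w w′ T (+-cancelˡ-≡ u _ _ (trans eq (cong (_+ T * w′) (sym u≡u′))))

  mixedRadix< : ∀ {M N a b} → a < M → b < N → a + M * b < M * N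
  mixedRadix< {M} {N} {a} {b} a<M b<N = begin-strict
    a + M * b <⟨ +-monoˡ-< (M * b) a<M ⟩
    M + M * b ≡⟨ *-suc M b ⟨
    M * suc b ≤⟨ *-monoʳ-≤ M b<N ⟩
    M * N     ∎
    where open ≤-Reasoning

  mixedRadix-unique : ∀ {M N a a′ b b′ w w′} → a < M → a′ < M → b < N → b′ < N →
                      a + M * b + M * N * w ≡ a′ + M * b′ + M * N * w′ → a ≡ a′ × b ≡ b′ × w ≡ w′
  mixedRadix-unique a<M a′<M b<N b′<N eq
    with digits≡ , w≡w′ ← divMod-unique (mixedRadix< a<M b<N) (mixedRadix< a′<M b′<N) eq
    with a≡a′ , b≡b′ ← divMod-unique a<M a′<M digits≡
    = a≡a′ , b≡b′ , w≡w′

  private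
    *-cancelˡ-modPrime-≤ : ∀ {p c k k′ x y} → Prime p → p ∤ c → k ≤ k′ → k′ < p →
                           c * k + p * x ≡ c * k′ + p * y → k ≡ k′
    *-cancelˡ-modPrime-≤ {p} {c} {k} {k′} {x} {y} pp p∤c k≤k′ k′<p eq =
      trans (sym (+-identityʳ k)) (trans (cong (k +_) (sym d≡0)) (m+[n∸m]≡n k≤k′))
      where
      d = k′ ∸ k
      px≡cd+py : p * x ≡ p * y + c * d
      px≡cd+py = +-cancelˡ-≡ (c * k) _ _ (begin
        c * k + p * x             ≡⟨ eq ⟩
        c * k′ + p * y            ≡⟨ cong (λ t → c * t + p * y) (m+[n∸m]≡n k≤k′) ⟨
        c * (k + d) + p * y       ≡⟨ solve 5 (λ c k d p y → c :* (k :+ d) :+ p :* y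
                                                := c :* k :+ (p :* y :+ c :* d)) refl c k d p y ⟩
        c * k + (p * y + c * d)   ∎)
        where open ≡-Reasoning
      p∣d : p ∣ d
      p∣d with euclidsLemma c d pp (∣m+n∣m⇒∣n (subst (p ∣_) px≡cd+py (m∣m*n x)) (m∣m*n y))
      ... | inj₁ p∣c = contradiction p∣c p∤c
      ... | inj₂ p∣d = p∣d
      instance
        p≢0 : NonZero p
        p≢0 = prime⇒nonZero pp
      d≡0 : d ≡ 0
      d≡0 = trans (sym (m<n⇒m%n≡m (≤-<-trans (m∸n≤m k′ k) k′<p))) (n∣m⇒m%n≡0 d p p∣d)

  *-cancelˡ-modPrime : ∀ {p c k k′ x y} → Prime p → p ∤ c → k < p → k′ < p →
                       c * k + p * x ≡ c * k′ + p * y → k ≡ k′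
  *-cancelˡ-modPrime {k = k} {k′} pp p∤c k<p k′<p eq with ≤-total k k′
  ... | inj₁ k≤k′ = *-cancelˡ-modPrime-≤ pp p∤c k≤k′ k′<p eq
  ... | inj₂ k′≤k = sym (*-cancelˡ-modPrime-≤ pp p∤c k′≤k k<p (sym eq))

  crt-digits : ∀ {p q k k′ l l′ x y} → Prime p → Prime q → p ≢ 2 → q ≢ 2 → p ≢ q →
               k < p → k′ < p → l < q → l′ < q →
               2 * q * k + 2 * p * l + p * q * x ≡ 2 * q * k′ + 2 * p * l′ + p * q * y →
               k ≡ k′ × l ≡ l′ × x ≡ y
  crt-digits {p} {q} {k} {k′} {l} {l′} {x} {y} pp pq p≢2 q≢2 p≢q k<p k′<p l<q l′<q eq =
    k≡k′ , l≡l′ , x≡y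
    where
    mod-p : ∀ k l x → 2 * q * k + 2 * p * l + p * q * x ≡ 2 * q * k + p * (2 * l + q * x)
    mod-p = solve 5 (λ p q k l x → con 2 :* q :* k :+ con 2 :* p :* l :+ p :* q :* x
                                  := con 2 :* q :* k :+ p :* (con 2 :* l :+ q :* x)) refl p q
    mod-q : ∀ k l x → 2 * q * k + 2 * p * l + p * q * x ≡ 2 * p * l + q * (2 * k + p * x)
    mod-q = solve 5 (λ p q k l x → con 2 :* q :* k :+ con 2 :* p :* l :+ p :* q :* x
                                  := con 2 :* p :* l :+ q :* (con 2 :* k :+ p :* x)) refl p q
    k≡k′ : k ≡ k′
    k≡k′ = *-cancelˡ-modPrime pp (prime∤2*prime pp pq p≢2 p≢q) k<p k′<p
             (trans (sym (mod-p k l x)) (trans eq (mod-p k′ l′ y)))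
    l≡l′ : l ≡ l′
    l≡l′ = *-cancelˡ-modPrime pq (prime∤2*prime pq pp q≢2 (p≢q ∘ sym)) l<q l′<q
             (trans (sym (mod-q k l x)) (trans eq (mod-q k′ l′ y)))
    x≡y : x ≡ y
    x≡y = *-cancelˡ-≡ x y (p * q) {{m*n≢0 p q {{prime⇒nonZero pp}} {{prime⇒nonZero pq}}}}
            (+-cancelˡ-≡ _ _ _ (trans eq (cong (_+ p * q * y) (sym digits≡))))
      where
      digits≡ : 2 * q * k + 2 * p * l ≡ 2 * q * k′ + 2 * p * l′
      digits≡ = cong₂ (λ k l → 2 * q * k + 2 * p * l) k≡k′ l≡l′

  prime∤⇒coprime-^ : ∀ {r n} → Prime r → r ∤ n → ∀ c → Coprime (r ^ c) n
  prime∤⇒coprime-^ pr r∤n zero          (i∣1 , _)    = ∣1⇒≡1 i∣1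
  prime∤⇒coprime-^ pr r∤n (suc c) {i} (i∣r^1+c , i∣n) =
    prime∤⇒coprime-^ pr r∤n c (coprime-divisor i⊥r i∣r^1+c , i∣n)
    where
    i⊥r : Coprime i _
    i⊥r (j∣i , j∣r) with prime⇒irreducible pr j∣r
    ... | inj₁ j≡1  = j≡1
    ... | inj₂ refl = contradiction (∣-trans j∣i i∣n) r∤n

  coprime⇒*∣ : ∀ {a b k} → Coprime a b → a ∣ k → b ∣ k → a * b ∣ k
  coprime⇒*∣ {a} {b} a⊥b (divides t k≡ta) b∣k =
    subst (a * b ∣_) (trans (*-comm a t) (sym k≡ta)) (*-monoʳ-∣ a (coprime-divisor (Coprime.sym a⊥b) b∣ta))
    where
    b∣ta : b ∣ a * t
    b∣ta = subst (b ∣_) (trans k≡ta (*-comm t a)) b∣k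

  ∃primeDivisor : ∀ d → 2 ≤ d → ∃[ r ] Prime r × r ∣ d
  ∃primeDivisor d@(suc _) 2≤d with factorise d
  ... | record { factors = [] ; isFactorisation = d≡1 } = contradiction d≡1 (>⇒≢ 2≤d)
  ... | record { factors = r ∷ rs ; isFactorisation = d≡r*rs ; factorsPrime = pr ∷ _ } =
    r , pr , subst (r ∣_) (sym d≡r*rs) (m∣m*n (product rs))

  split-primePower : ∀ {r} → Prime r → ∀ e → 0 < e → ∃₂ λ b e₀ → e ≡ r ^ b * e₀ × r ∤ e₀
  split-primePower {r} pr = <-rec _ split
    where
    split : ∀ e → (∀ {e′} → e′ < e → 0 < e′ → ∃₂ λ b e₀ → e′ ≡ r ^ b * e₀ × r ∤ e₀) →
            0 < e → ∃₂ λ b e₀ → e ≡ r ^ b * e₀ × r ∤ e₀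
    split e rec 0<e with r ∣? e
    ... | no r∤e = 0 , e , sym (+-identityʳ e) , r∤e
    ... | yes (divides e′ e≡e′r) with rec e′<e 0<e′
      where
      0<e′ : 0 < e′
      0<e′ = 0<*⇒0<ˡ (subst (0 <_) e≡e′r 0<e)
      e′<e : e′ < e
      e′<e = subst (e′ <_) (sym e≡e′r) (m<m*n e′ r {{>-nonZero 0<e′}} (prime⇒2≤ pr))
    ...   | b , e₀ , e′≡rᵇe₀ , r∤e₀ = suc b , e₀ , e≡r¹⁺ᵇe₀ , r∤e₀
      where
      e≡r¹⁺ᵇe₀ : e ≡ r * r ^ b * e₀
      e≡r¹⁺ᵇe₀ = begin
        e              ≡⟨ e≡e′r ⟩
        e′ * r         ≡⟨ cong (_* r) e′≡rᵇe₀ ⟩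
        r ^ b * e₀ * r ≡⟨ solve 3 (λ x y z → x :* y :* z := z :* x :* y) refl (r ^ b) e₀ r ⟩
        r * r ^ b * e₀ ∎
        where open ≡-Reasoning

  -- Split off a prime factor r of d: if r ∤ e then r ^ 1 works, otherwise recurse on d / r ∤ e / r.
  ∤⇒primePower∤ : ∀ d → 0 < d → ∀ e → d ∤ e → ∃₂ λ r c → Prime r × r ^ c ∣ d × r ^ c ∤ e
  ∤⇒primePower∤ = <-rec _ step
    where
    step : ∀ d → (∀ {d′} → d′ < d → 0 < d′ → ∀ e → d′ ∤ e → ∃₂ λ r c → Prime r × r ^ c ∣ d′ × r ^ c ∤ e) →
           0 < d → ∀ e → d ∤ e → ∃₂ λ r c → Prime r × r ^ c ∣ d × r ^ c ∤ e
    step 1 _ _ e 1∤e = contradiction (1∣ e) 1∤e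
    step d@(suc (suc _)) rec _ e d∤e with ∃primeDivisor d (s≤s (s≤s z≤n))
    ... | r , pr , divides d′ d≡d′r with r ∣? e
    ...   | no r∤e = r , 1 , pr , subst (_∣ d) (sym (^-identityʳ r)) (divides d′ d≡d′r) ,
                     r∤e ∘ subst (_∣ e) (^-identityʳ r)
    ...   | yes (divides e′ e≡e′r) with rec d′<d 0<d′ e′ d′∤e′
      where
      0<d′ : 0 < d′
      0<d′ = 0<*⇒0<ˡ (subst (0 <_) d≡d′r z<s)
      d′<d : d′ < d
      d′<d = subst (d′ <_) (sym d≡d′r) (m<m*n d′ r {{>-nonZero 0<d′}} (prime⇒2≤ pr))
      d′∤e′ : d′ ∤ e′
      d′∤e′ d′∣e′ = d∤e (subst₂ _∣_ (sym d≡d′r) (sym e≡e′r) (*-pres-∣ d′∣e′ (∣-refl {r})))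
    ...     | r′ , c , pr′ , r′ᶜ∣d′ , r′ᶜ∤e′ with r′ ≟ r
    ...       | yes refl = r , suc c , pr , r¹⁺ᶜ∣d , r¹⁺ᶜ∤e
      where
      instance
        r≢0 : NonZero r
        r≢0 = prime⇒nonZero pr
      r¹⁺ᶜ∣d : r ^ suc c ∣ d
      r¹⁺ᶜ∣d = subst (r ^ suc c ∣_) (trans (*-comm r d′) (sym d≡d′r)) (*-monoʳ-∣ r r′ᶜ∣d′)
      r¹⁺ᶜ∤e : r ^ suc c ∤ e
      r¹⁺ᶜ∤e r¹⁺ᶜ∣e = r′ᶜ∤e′ (*-cancelˡ-∣ r (subst (r ^ suc c ∣_) (trans e≡e′r (*-comm e′ r)) r¹⁺ᶜ∣e))
    ...       | no r′≢r = r′ , c , pr′ , r′ᶜ∣d , r′ᶜ∤e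
      where
      r′ᶜ∣d : r′ ^ c ∣ d
      r′ᶜ∣d = subst (r′ ^ c ∣_) (sym d≡d′r) (∣-trans r′ᶜ∣d′ (m∣m*n r))
      r′ᶜ∤e : r′ ^ c ∤ e
      r′ᶜ∤e r′ᶜ∣e = r′ᶜ∤e′ (coprime-divisor (prime∤⇒coprime-^ pr′ (prime∤prime pr′ pr r′≢r) c)
                                             (subst (r′ ^ c ∣_) (trans e≡e′r (*-comm e′ r)) r′ᶜ∣e))

  ^-monoʳ-∣ : ∀ r {b c} → b ≤ c → r ^ b ∣ r ^ c
  ^-monoʳ-∣ r {b} {c} b≤c = divides (r ^ (c ∸ b)) (begin
    r ^ c                 ≡⟨ cong (r ^_) (m+[n∸m]≡n b≤c) ⟨
    r ^ (b + (c ∸ b))     ≡⟨ ^-distribˡ-+-* r b (c ∸ b) ⟩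
    r ^ b * r ^ (c ∸ b)   ≡⟨ *-comm (r ^ b) _ ⟩
    r ^ (c ∸ b) * r ^ b   ∎)
    where open ≡-Reasoning

  ∤⇒higherPrimePower : ∀ {d e} → 0 < d → 0 < e → d ∤ e →
                       ∃₂ λ r c → ∃₂ λ b e₀ → Prime r × r ^ c ∣ d × e ≡ r ^ b * e₀ × r ∤ e₀ × e < r ^ c * e₀
  ∤⇒higherPrimePower {d} {e} 0<d 0<e d∤e
    with r , c , pr , rᶜ∣d , rᶜ∤e ← ∤⇒primePower∤ d 0<d e d∤e
    with b , e₀ , e≡rᵇe₀ , r∤e₀ ← split-primePower pr e 0<e
    = r , c , b , e₀ , pr , rᶜ∣d , e≡rᵇe₀ , r∤e₀ , e<rᶜe₀
    where
    b<c : b < c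
    b<c = ≰⇒> (λ c≤b → rᶜ∤e (subst (r ^ c ∣_) (sym e≡rᵇe₀) (∣-trans (^-monoʳ-∣ r c≤b) (m∣m*n e₀))))
    e<rᶜe₀ : e < r ^ c * e₀
    e<rᶜe₀ = subst (_< r ^ c * e₀) (sym e≡rᵇe₀)
               (*-monoˡ-< e₀ {{>-nonZero (0<*⇒0<ʳ {r ^ b} (subst (0 <_) e≡rᵇe₀ 0<e))}} (^-monoʳ-< r (prime⇒2≤ pr) b<c))

  ∃-argmax : ∀ {n} (f : Fin (suc n) → ℕ) → ∃[ i ] ∀ j → f j ≤ f i
  ∃-argmax {zero}  f = zero , λ { zero → ≤-refl }
  ∃-argmax {suc n} f with i , f∘suc≤fᵢ ← ∃-argmax (f ∘ suc) | f zero ≤? f (suc i)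
  ... | yes f₀≤ = suc i , λ { zero → f₀≤ ; (suc j) → f∘suc≤fᵢ j }
  ... | no  f₀≰ = zero  , λ { zero → ≤-refl ; (suc j) → ≤-trans (f∘suc≤fᵢ j) (<⇒≤ (≰⇒> f₀≰)) }

  remQuot-injective : ∀ {m} n {i j : Fin (m * n)} → remQuot {m} n i ≡ remQuot n j → i ≡ j
  remQuot-injective {m} n {i} {j} eq =
    trans (sym (combine-remQuot {m} n i)) (trans (cong (uncurry combine) eq) (combine-remQuot {m} n j))

open NatArithmetic

module MultiplicativeOrder {c ℓ} (R : CommutativeSemiring c ℓ) where
  open CommutativeSemiring R
  open import Algebra.Properties.CommutativeSemiring.Exp R
  open import Data.Nat using (zero; suc; NonZero; _<_; _≤_; z<s)
  open import Data.Nat.DivMod using (_%_; _/_; m≡m%n+[m/n]*n)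
  open import Data.Nat.Divisibility using (_∣_; divides; ∣-antisym; *-cancelˡ-∣; 1∣_; _∣?_; ∣⇒≤; m∣m*n; n∣m*n)
  open import Data.Nat.Coprimality using (Coprime; coprime-divisor)
  import Data.Nat.Coprimality as Coprime
  open import Level using (_⊔_)
  open import Relation.Nullary using (yes; no; contradiction)
  open import Relation.Binary.Reasoning.Setoid setoid

  record IsOrder (x : Carrier) (d : ℕ) : Set (c ⊔ ℓ) where
    field
      order>0  : 0 < d
      ^order≈1 : x ^ d ≈ 1#
      order∣   : ∀ {k} → x ^ k ≈ 1# → d ∣ k

  open IsOrder

  1^n≈1 : ∀ n → 1# ^ n ≈ 1#
  1^n≈1 zero    = refl
  1^n≈1 (suc n) = trans (*-identityˡ _) (1^n≈1 n)

  ∣⇒^≈1 : ∀ x d {k} → x ^ d ≈ 1# → d ∣ k → x ^ k ≈ 1#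
  ∣⇒^≈1 x d {k} x^d≈1 (divides t k≡td) = begin
    x ^ k           ≡⟨ ≡.cong (x ^_) (≡.trans k≡td (ℕ.*-comm t d)) ⟩
    x ^ (d ℕ.* t)   ≈⟨ ^-assocʳ x d t ⟨
    (x ^ d) ^ t     ≈⟨ ^-congˡ t x^d≈1 ⟩
    1# ^ t          ≈⟨ 1^n≈1 t ⟩
    1#              ∎

  ^-mod : ∀ {x d} k .{{_ : NonZero d}} → x ^ d ≈ 1# → x ^ k ≈ x ^ (k % d)
  ^-mod {x} {d} k x^d≈1 = begin
    x ^ k                            ≡⟨ ≡.cong (x ^_) (m≡m%n+[m/n]*n k d) ⟩
    x ^ (k % d ℕ.+ k / d ℕ.* d)      ≈⟨ ^-homo-* x (k % d) _ ⟩
    x ^ (k % d) * x ^ (k / d ℕ.* d)  ≈⟨ *-congˡ (∣⇒^≈1 x d x^d≈1 (divides (k / d) ≡.refl)) ⟩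
    x ^ (k % d) * 1#                 ≈⟨ *-identityʳ _ ⟩
    x ^ (k % d)                      ∎

  IsOrder-unique : ∀ {x d d′} → IsOrder x d → IsOrder x d′ → d ≡ d′
  IsOrder-unique o o′ = ∣-antisym (order∣ o (^order≈1 o′)) (order∣ o′ (^order≈1 o))

  IsOrder-cong : ∀ {x y d} → x ≈ y → IsOrder x d → IsOrder y d
  IsOrder-cong {d = d} x≈y o = record
    { order>0  = order>0 o
    ; ^order≈1 = trans (^-congˡ d (sym x≈y)) (^order≈1 o)
    ; order∣   = λ {k} y^k≈1 → order∣ o (trans (^-congˡ k x≈y) y^k≈1)
    }

  IsOrder-1 : IsOrder 1# 1
  IsOrder-1 = record { order>0 = z<s ; ^order≈1 = *-identityʳ 1# ; order∣ = λ {k} _ → 1∣ k }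

  IsOrder⇒≉1 : ∀ {x d} → IsOrder x d → 1 < d → x ≉ 1#
  IsOrder⇒≉1 o 1<d x≈1 = ℕ.<⇒≱ 1<d (∣⇒≤ (order∣ o (trans (*-identityʳ _) x≈1)))

  IsOrder-^ : ∀ {x} t {s} → IsOrder x (t ℕ.* s) → IsOrder (x ^ t) s
  IsOrder-^ {x} t {s} o = record
    { order>0  = 0<*⇒0<ʳ {t} (order>0 o)
    ; ^order≈1 = trans (^-assocʳ x t s) (^order≈1 o)
    ; order∣   = λ {k} x^tk≈1 → *-cancelˡ-∣ t {{ℕ.>-nonZero (0<*⇒0<ˡ (order>0 o))}}
                                   (order∣ o (trans (sym (^-assocʳ x t k)) x^tk≈1))
    }

  private
    order∣-*ˡ : ∀ {x y a b k} → IsOrder x a → IsOrder y b → Coprime a b → (x * y) ^ k ≈ 1# → a ∣ k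
    order∣-*ˡ {x} {y} {a} {b} {k} ox oy a⊥b xy^k≈1 = coprime-divisor a⊥b (order∣ ox x^bk≈1)
      where
      x^bk≈1 : x ^ (b ℕ.* k) ≈ 1#
      x^bk≈1 = begin
        x ^ (b ℕ.* k)                 ≈⟨ *-identityʳ _ ⟨
        x ^ (b ℕ.* k) * 1#            ≈⟨ *-congˡ (∣⇒^≈1 y b (^order≈1 oy) (m∣m*n k)) ⟨
        x ^ (b ℕ.* k) * y ^ (b ℕ.* k) ≈⟨ ^-distrib-* x y (b ℕ.* k) ⟨
        (x * y) ^ (b ℕ.* k)           ≈⟨ ∣⇒^≈1 (x * y) k xy^k≈1 (n∣m*n b) ⟩
        1#                            ∎

  IsOrder-* : ∀ {x y a b} → IsOrder x a → IsOrder y b → Coprime a b → IsOrder (x * y) (a ℕ.* b)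
  IsOrder-* {x} {y} {a} {b} ox oy a⊥b = record
    { order>0  = ℕ.*-mono-< (order>0 ox) (order>0 oy)
    ; ^order≈1 = begin
        (x * y) ^ (a ℕ.* b)           ≈⟨ ^-distrib-* x y (a ℕ.* b) ⟩
        x ^ (a ℕ.* b) * y ^ (a ℕ.* b) ≈⟨ *-cong (∣⇒^≈1 x a (^order≈1 ox) (m∣m*n b))
                                                 (∣⇒^≈1 y b (^order≈1 oy) (n∣m*n a)) ⟩
        1# * 1#                       ≈⟨ *-identityʳ 1# ⟩
        1#                            ∎
    ; order∣   = λ {k} xy^k≈1 → coprime⇒*∣ a⊥b (order∣-*ˡ ox oy a⊥b xy^k≈1)
                   (order∣-*ˡ oy ox (Coprime.sym a⊥b) (trans (^-congˡ k (*-comm y x)) xy^k≈1))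
    }

  -- If d ∤ e, some prime power r ^ c divides d = t * r ^ c but not e = r ^ b * e₀ (r ∤ e₀, so b < c),
  -- and then y ^ t * g ^ (r ^ b) would have order r ^ c * e₀ > e.
  order∣maxOrder : ∀ {g e y d} → IsOrder g e → (∀ {x d} → IsOrder x d → d ≤ e) → IsOrder y d → d ∣ e
  order∣maxOrder {g} {e} {y} {d} og maximal oy with d ∣? e
  ... | yes d∣e = d∣e
  ... | no d∤e
    with r , c , b , e₀ , pr , divides t d≡trᶜ , e≡rᵇe₀ , r∤e₀ , e<rᶜe₀
           ← ∤⇒higherPrimePower (order>0 oy) (order>0 og) d∤e
    = contradiction (maximal larger) (ℕ.<⇒≱ e<rᶜe₀)
    where
    larger : IsOrder (y ^ t * g ^ (r ℕ.^ b)) (r ℕ.^ c ℕ.* e₀)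
    larger = IsOrder-* (IsOrder-^ t (≡.subst (IsOrder y) d≡trᶜ oy))
                       (IsOrder-^ (r ℕ.^ b) (≡.subst (IsOrder g) e≡rᵇe₀ og))
                       (prime∤⇒coprime-^ pr r∤e₀ c)

module FinSum {a ℓ} (M : Monoid a ℓ) where
  open Monoid M renaming (_∙_ to _+_; ∙-congˡ to +-congˡ; identityˡ to +-identityˡ; assoc to +-assoc)
  open import Algebra.Properties.Monoid.Sum M using (sum)
  open import Data.Fin using (_↑ˡ_; _↑ʳ_; combine)

  sum-++ : ∀ m {n} (f : Fin (m ℕ.+ n) → Carrier) →
           sum f ≈ sum (λ i → f (i ↑ˡ n)) + sum (λ j → f (m ↑ʳ j))
  sum-++ zero    f = sym (+-identityˡ _)
  sum-++ (suc m) {n} f = trans (+-congˡ (sum-++ m {n} (λ i → f (suc i)))) (sym (+-assoc _ _ _))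

  sum-combine : ∀ m {n} (f : Fin (m ℕ.* n) → Carrier) →
                sum f ≈ sum (λ (i : Fin m) → sum (λ (j : Fin n) → f (combine i j)))
  sum-combine zero    f = refl
  sum-combine (suc m) {n} f = trans (sum-++ n f) (+-congˡ (sum-combine m (λ i → f (n ↑ʳ i))))

module FieldProperties {c ℓ} (F : CommutativeRing c ℓ) (isField : IsField F) where
  open CommutativeRing F hiding (zero)
  open IsField isField
  open import Algebra.Properties.Ring ring using (x[y-z]≈xy-xz; x∙y⁻¹≈ε⇒x≈y; +-inverseˡ-unique; +-cancelʳ)
  open import Algebra.Properties.CommutativeSemiring.Exp commutativeSemiring
  open import Algebra.Properties.Semiring.Sum semiring using (sum; *-distribˡ-sum; sum-cong-≋; sum-replicate-zero)
  open import Algebra.Solver.Ring.NaturalCoefficients.Default commutativeSemiring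
  open import Data.Fin using (combine; quotient; remainder)
  open import Data.Fin.Properties using (remQuot-combine)
  open import Data.Nat.Divisibility using (_∣_)
  open import Relation.Nullary using (contradiction)
  open import Relation.Binary.Reasoning.Setoid setoid
  open FinSum +-monoid using (sum-combine)
  open MultiplicativeOrder commutativeSemiring
  open IsOrder

  x*y≈0⇒y≈0 : ∀ {x y} → x ≉ 0# → x * y ≈ 0# → y ≈ 0#
  x*y≈0⇒y≈0 {x} {y} x≉0 xy≈0 with x⁻¹ , xx⁻¹≈1 ← inverse x x≉0 = begin
    y             ≈⟨ *-identityˡ y ⟨
    1# * y        ≈⟨ *-congʳ xx⁻¹≈1 ⟨
    x * x⁻¹ * y   ≈⟨ solve 3 (λ x x⁻¹ y → x :* x⁻¹ :* y := x⁻¹ :* (x :* y)) refl x x⁻¹ y ⟩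
    x⁻¹ * (x * y) ≈⟨ *-congˡ xy≈0 ⟩
    x⁻¹ * 0#      ≈⟨ zeroʳ x⁻¹ ⟩
    0#            ∎

  *-nonzero : ∀ {x y} → x ≉ 0# → y ≉ 0# → x * y ≉ 0#
  *-nonzero x≉0 y≉0 xy≈0 = y≉0 (x*y≈0⇒y≈0 x≉0 xy≈0)

  ^-nonzero : ∀ {x} k → x ≉ 0# → x ^ k ≉ 0#
  ^-nonzero zero    x≉0 = 1≉0
  ^-nonzero (suc k) x≉0 = *-nonzero x≉0 (^-nonzero k x≉0)

  *-cancelˡ-nonzero : ∀ {x y z} → x ≉ 0# → x * y ≈ x * z → y ≈ z
  *-cancelˡ-nonzero {x} {y} {z} x≉0 xy≈xz = x∙y⁻¹≈ε⇒x≈y y z (x*y≈0⇒y≈0 x≉0 (begin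
    x * (y - z)   ≈⟨ x[y-z]≈xy-xz x y z ⟩
    x * y - x * z ≈⟨ +-congʳ xy≈xz ⟩
    x * z - x * z ≈⟨ -‿inverseʳ (x * z) ⟩
    0#            ∎))

  x²≈1⇒x≈-1 : ∀ {x} → x * x ≈ 1# → x ≉ 1# → x ≈ - 1#
  x²≈1⇒x≈-1 {x} x²≈1 x≉1 = +-inverseˡ-unique x 1# (x*y≈0⇒y≈0 x-1≉0 (trans (*-comm _ _) [x+1][x-1]≈0))
    where
    x-1≉0 : x - 1# ≉ 0#
    x-1≉0 x-1≈0 = x≉1 (x∙y⁻¹≈ε⇒x≈y x 1# x-1≈0)
    [x+1][x-1]≈0 : (x + 1#) * (x - 1#) ≈ 0#
    [x+1][x-1]≈0 = begin
      (x + 1#) * (x - 1#)            ≈⟨ x[y-z]≈xy-xz (x + 1#) x 1# ⟩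
      (x + 1#) * x - (x + 1#) * 1#   ≈⟨ +-cong (distribʳ x x 1#) (-‿cong (*-identityʳ _)) ⟩
      (x * x + 1# * x) - (x + 1#)    ≈⟨ +-congʳ (+-cong x²≈1 (*-identityˡ x)) ⟩
      (1# + x) - (x + 1#)            ≈⟨ +-congʳ (+-comm 1# x) ⟩
      (x + 1#) - (x + 1#)            ≈⟨ -‿inverseʳ (x + 1#) ⟩
      0#                             ∎

  IsOrder⇒≉0 : ∀ {x d} → IsOrder x d → x ≉ 0#
  IsOrder⇒≉0 {d = zero}  o     = contradiction (order>0 o) (λ ())
  IsOrder⇒≉0 {d = suc _} o x≈0 = 1≉0 (begin
    1#         ≈⟨ ^order≈1 o ⟨
    _ * _      ≈⟨ *-congʳ x≈0 ⟩
    0# * _     ≈⟨ zeroˡ _ ⟩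
    0#         ∎)

  private
    ^-injective-mod-≤ : ∀ {g K x y} → IsOrder g K → x ℕ.≤ y → g ^ x ≈ g ^ y →
                        ∃₂ λ X Y → x ℕ.+ X ℕ.* K ≡ y ℕ.+ Y ℕ.* K
    ^-injective-mod-≤ {g} {K} {x} {y} og x≤y gˣ≈gʸ = _∣_.quotient K∣y∸x , 0 ,
      ≡.trans (≡.cong (x ℕ.+_) (≡.sym (_∣_.equality K∣y∸x))) (≡.trans (ℕ.m+[n∸m]≡n x≤y) (≡.sym (ℕ.+-identityʳ y)))
      where
      gʸ⁻ˣ≈1 : g ^ (y ℕ.∸ x) ≈ 1#
      gʸ⁻ˣ≈1 = *-cancelˡ-nonzero (^-nonzero x (IsOrder⇒≉0 og)) (begin
        g ^ x * g ^ (y ℕ.∸ x) ≈⟨ ^-homo-* g x (y ℕ.∸ x) ⟨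
        g ^ (x ℕ.+ (y ℕ.∸ x)) ≡⟨ ≡.cong (g ^_) (ℕ.m+[n∸m]≡n x≤y) ⟩
        g ^ y                 ≈⟨ gˣ≈gʸ ⟨
        g ^ x                 ≈⟨ *-identityʳ _ ⟨
        g ^ x * 1#            ∎)
      K∣y∸x : K ∣ y ℕ.∸ x
      K∣y∸x = order∣ og gʸ⁻ˣ≈1

  ^-injective-mod : ∀ {g K x y} → IsOrder g K → g ^ x ≈ g ^ y → ∃₂ λ X Y → x ℕ.+ X ℕ.* K ≡ y ℕ.+ Y ℕ.* K
  ^-injective-mod {x = x} {y} og gˣ≈gʸ with ℕ.≤-total x y
  ... | inj₁ x≤y = ^-injective-mod-≤ og x≤y gˣ≈gʸ
  ... | inj₂ y≤x with X , Y , eq ← ^-injective-mod-≤ og y≤x (sym gˣ≈gʸ) = Y , X , ≡.sym eq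

  ^half≈-1 : ∀ {g h} → IsOrder g (2 ℕ.* h) → g ^ h ≈ - 1#
  ^half≈-1 {g} {h} og = x²≈1⇒x≈-1 (trans (*-congˡ (sym (*-identityʳ _))) (^order≈1 gʰ-order2))
                                  (IsOrder⇒≉1 gʰ-order2 (ℕ.s≤s (ℕ.s≤s ℕ.z≤n)))
    where
    gʰ-order2 : IsOrder (g ^ h) 2
    gʰ-order2 = IsOrder-^ h (≡.subst (IsOrder g) (ℕ.*-comm 2 h) og)

  -- (β - 1) (1 + β + ⋯ + β ^ (n - 1)) = β ^ n - 1, with both sides moved so that no subtraction occurs.
  geometric-sum : ∀ β n → β * sum (λ (i : Fin n) → β ^ toℕ i) + 1# ≈ sum (λ (i : Fin n) → β ^ toℕ i) + β ^ n
  geometric-sum β zero    = +-congʳ (zeroʳ β)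
  geometric-sum β (suc n) = begin
    β * (1# + S) + 1#        ≈⟨ +-congʳ (*-congˡ (+-congˡ S≈βG)) ⟩
    β * (1# + β * G) + 1#    ≈⟨ solve 2 (λ β G → β :* (con 1 :+ β :* G) :+ con 1
                                              := con 1 :+ β :* (β :* G :+ con 1)) refl β G ⟩
    1# + β * (β * G + 1#)    ≈⟨ +-congˡ (*-congˡ (geometric-sum β n)) ⟩
    1# + β * (G + β ^ n)     ≈⟨ solve 3 (λ β G βⁿ → con 1 :+ β :* (G :+ βⁿ)
                                              := (con 1 :+ β :* G) :+ β :* βⁿ) refl β G (β ^ n) ⟩
    1# + β * G + β * β ^ n   ≈⟨ +-congʳ (+-congˡ S≈βG) ⟨
    1# + S + β * β ^ n       ∎
    where
    G = sum (λ (i : Fin n) → β ^ toℕ i)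
    S = sum (λ (i : Fin n) → β ^ toℕ (suc i))
    S≈βG : S ≈ β * G
    S≈βG = sym (*-distribˡ-sum β (λ (i : Fin n) → β ^ toℕ i))

  geometric-sum≈0 : ∀ {β P} → β ^ P ≈ 1# → β ≉ 1# → sum (λ (i : Fin P) → β ^ toℕ i) ≈ 0#
  geometric-sum≈0 {β} {P} βᴾ≈1 β≉1 = x*y≈0⇒y≈0 β-1≉0 (begin
    (β - 1#) * G        ≈⟨ *-comm _ G ⟩
    G * (β - 1#)        ≈⟨ x[y-z]≈xy-xz G β 1# ⟩
    G * β - G * 1#      ≈⟨ +-cong (*-comm G β) (-‿cong (*-identityʳ G)) ⟩
    β * G - G           ≈⟨ +-congʳ βG≈G ⟩
    G - G               ≈⟨ -‿inverseʳ G ⟩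
    0#                  ∎)
    where
    G = sum (λ (i : Fin P) → β ^ toℕ i)
    β-1≉0 : β - 1# ≉ 0#
    β-1≉0 β-1≈0 = β≉1 (x∙y⁻¹≈ε⇒x≈y β 1# β-1≈0)
    βG≈G : β * G ≈ G
    βG≈G = +-cancelʳ 1# _ _ (trans (geometric-sum β P) (+-congˡ βᴾ≈1))

  sum-blocks≈0 : ∀ {M P β} (h : Fin M → Carrier) → β ^ P ≈ 1# → β ≉ 1# →
                 sum (λ (r : Fin (M ℕ.* P)) → h (quotient {M} P r) * β ^ toℕ (remainder {M} P r)) ≈ 0#
  sum-blocks≈0 {M} {P} {β} h βᴾ≈1 β≉1 = begin
    sum f                                                        ≈⟨ sum-combine M f ⟩
    sum (λ (a : Fin M) → sum (λ (k : Fin P) → f (combine a k)))  ≈⟨ sum-cong-≋ block≈0 ⟩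
    sum (λ (a : Fin M) → 0#)                                     ≈⟨ sum-replicate-zero M ⟩
    0#                                                           ∎
    where
    f : Fin (M ℕ.* P) → Carrier
    f r = h (quotient {M} P r) * β ^ toℕ (remainder {M} P r)
    f∘combine≈ : ∀ a k → f (combine a k) ≈ h a * β ^ toℕ k
    f∘combine≈ a k = reflexive (≡.cong (λ (b , l) → h b * β ^ toℕ l) (remQuot-combine {M} {P} a k))
    block≈0 : ∀ a → sum (λ (k : Fin P) → f (combine a k)) ≈ 0#
    block≈0 a = begin
      sum (λ (k : Fin P) → f (combine a k)) ≈⟨ sum-cong-≋ (f∘combine≈ a) ⟩
      sum (λ (k : Fin P) → h a * β ^ toℕ k) ≈⟨ *-distribˡ-sum (h a) (λ (k : Fin P) → β ^ toℕ k) ⟨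
      h a * sum (λ (k : Fin P) → β ^ toℕ k) ≈⟨ *-congˡ (geometric-sum≈0 {β} {P} βᴾ≈1 β≉1) ⟩
      h a * 0#                             ≈⟨ zeroʳ (h a) ⟩
      0#                                   ∎

  ∑≡sum : ∀ n (f : Fin n → Carrier) → ∑ F n f ≡ sum f
  ∑≡sum zero    f = ≡.refl
  ∑≡sum (suc n) f = ≡.cong (f zero +_) (∑≡sum n (λ i → f (suc i)))

module MonicPolynomials {c ℓ} (F : CommutativeRing c ℓ) (isField : IsField F) where
  open CommutativeRing F hiding (zero)
  open IsField isField
  open FieldProperties F isField using (x*y≈0⇒y≈0)
  open import Algebra.Properties.Ring ring using (x∙y⁻¹≈ε⇒x≈y)
  open import Algebra.Properties.CommutativeSemiring.Exp commutativeSemiring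
  open import Algebra.Solver.Ring.NaturalCoefficients.Default commutativeSemiring
  open import Data.Fin.Properties using (suc-injective)
  open import Data.List using (List; []; _∷_; length; replicate)
  open import Relation.Nullary using (contradiction)
  open import Relation.Binary.Reasoning.Setoid setoid

  -- cs = c₀ ∷ ⋯ ∷ cₙ₋₁ encodes the monic polynomial c₀ + c₁ y + ⋯ + cₙ₋₁ y ^ (n - 1) + y ^ n of degree n.
  evalMonic : List Carrier → Carrier → Carrier
  evalMonic []       y = 1#
  evalMonic (c ∷ cs) y = c + y * evalMonic cs y

  -- The quotient of c + y * evalMonic cs y by y - a, whatever the constant term c.
  syntheticDivision : Carrier → List Carrier → List Carrier
  syntheticDivision a []       = []
  syntheticDivision a (c ∷ cs) = evalMonic (c ∷ cs) a ∷ syntheticDivision a cs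

  length-syntheticDivision : ∀ a cs → length (syntheticDivision a cs) ≡ length cs
  length-syntheticDivision a []       = ≡.refl
  length-syntheticDivision a (c ∷ cs) = ≡.cong suc (length-syntheticDivision a cs)

  private
    y≈[y-a]+a : ∀ y a → y ≈ (y - a) + a
    y≈[y-a]+a y a = begin
      y              ≈⟨ +-identityʳ y ⟨
      y + 0#         ≈⟨ +-congˡ (-‿inverseˡ a) ⟨
      y + (- a + a)  ≈⟨ +-assoc y (- a) a ⟨
      (y - a) + a    ∎

  -- The substitution y = (y - a) + a lets the semiring solver handle the subtraction.
  syntheticDivision-correct : ∀ a cs y →
    y * evalMonic cs y ≈ (y - a) * evalMonic (syntheticDivision a cs) y + a * evalMonic cs a
  syntheticDivision-correct a []       y = trans (*-congʳ (y≈[y-a]+a y a)) (distribʳ 1# (y - a) a)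
  syntheticDivision-correct a (c ∷ cs) y = begin
    y * (c + y * P)                        ≈⟨ *-congˡ (+-congˡ (syntheticDivision-correct a cs y)) ⟩
    y * (c + (d * Q + a * Pa))             ≈⟨ *-congʳ (y≈[y-a]+a y a) ⟩
    (d + a) * (c + (d * Q + a * Pa))       ≈⟨ solve 5 (λ d a c Q Pa → (d :+ a) :* (c :+ (d :* Q :+ a :* Pa))
                                                 := d :* ((c :+ a :* Pa) :+ (d :+ a) :* Q) :+ a :* (c :+ a :* Pa))
                                                refl d a c Q Pa ⟩
    d * ((c + a * Pa) + (d + a) * Q) + a * (c + a * Pa)
                                           ≈⟨ +-congʳ (*-congˡ (+-congˡ (*-congʳ (y≈[y-a]+a y a)))) ⟨
    d * ((c + a * Pa) + y * Q) + a * (c + a * Pa) ∎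
    where
    d  = y - a
    P  = evalMonic cs y
    Q  = evalMonic (syntheticDivision a cs) y
    Pa = evalMonic cs a

  monic-roots≤degree : ∀ cs {k} (z : Fin k → Carrier) → (∀ i → evalMonic cs (z i) ≈ 0#) →
                       (∀ i j → z i ≈ z j → i ≡ j) → k ℕ.≤ length cs
  monic-roots≤degree cs       {zero}  z _    _   = ℕ.z≤n
  monic-roots≤degree []       {suc k} z root _   = contradiction (root zero) 1≉0
  monic-roots≤degree (c ∷ cs) {suc k} z root inj =
    ℕ.s≤s (≡.subst (k ℕ.≤_) (length-syntheticDivision a cs)
             (monic-roots≤degree (syntheticDivision a cs) (z ∘ suc) root′
                                 (λ i j → suc-injective ∘ inj (suc i) (suc j))))
    where
    a = z zero
    root′ : ∀ i → evalMonic (syntheticDivision a cs) (z (suc i)) ≈ 0#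
    root′ i = x*y≈0⇒y≈0 y-a≉0 (begin
      d * Q                 ≈⟨ +-identityʳ _ ⟨
      d * Q + 0#            ≈⟨ +-congˡ (root zero) ⟨
      d * Q + (c + a * Pa)  ≈⟨ solve 3 (λ dQ c aPa → dQ :+ (c :+ aPa) := c :+ (dQ :+ aPa)) refl (d * Q) c (a * Pa) ⟩
      c + (d * Q + a * Pa)  ≈⟨ +-congˡ (syntheticDivision-correct a cs y) ⟨
      c + y * P             ≈⟨ root (suc i) ⟩
      0#                    ∎)
      where
      y  = z (suc i)
      d  = y - a
      P  = evalMonic cs y
      Q  = evalMonic (syntheticDivision a cs) y
      Pa = evalMonic cs a
      y-a≉0 : d ≉ 0#
      y-a≉0 y-a≈0 with () ← inj (suc i) zero (x∙y⁻¹≈ε⇒x≈y y a y-a≈0)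

  evalMonic-replicate : ∀ t y → evalMonic (replicate t 0#) y ≈ y ^ t
  evalMonic-replicate zero    y = refl
  evalMonic-replicate (suc t) y = trans (+-identityˡ _) (*-congˡ (evalMonic-replicate t y))

module FiniteField {c ℓ} (F : CommutativeRing c ℓ) (isField : IsField F) (K : ℕ)
                   (card : Inverse (CommutativeRing.setoid F) (≡.setoid (Fin (suc K)))) where
  open CommutativeRing F hiding (zero)
  open IsField isField
  open Inverse card
  open import Algebra.Properties.CommutativeSemiring.Exp commutativeSemiring
  open import Data.Nat.Divisibility using (_∣_; m%n≡0⇒n∣m)
  open import Data.Nat.DivMod using (_%_; m%n<n)
  import Data.Fin as Fin
  open import Data.Fin.Properties
    using (pigeonhole; punchOut-injective; any?; ¬∀⟶∃¬-smallest; toℕ-fromℕ; toℕ-fromℕ<; toℕ-inject; toℕ<n)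
  open import Data.List using (List; _∷_; replicate)
  open import Data.List.Properties using (length-replicate)
  open import Data.Empty using (⊥; ⊥-elim)
  open import Relation.Nullary using (¬_; yes; no; ¬?; contradiction)
  open import Relation.Nullary.Decidable using (map′; decidable-stable)
  open import Relation.Binary.Definitions using (Decidable)
  open import Relation.Binary.Reasoning.Setoid setoid
  open FieldProperties F isField
  open MonicPolynomials F isField
  open MultiplicativeOrder commutativeSemiring
  open IsOrder

  to-injective : ∀ {x y} → to x ≡ to y → x ≈ y
  to-injective {x} {y} eq = begin
    x           ≈⟨ strictlyInverseʳ x ⟨
    from (to x) ≡⟨ ≡.cong from eq ⟩
    from (to y) ≈⟨ strictlyInverseʳ y ⟩
    y           ∎

  infix 4 _≟_
  _≟_ : Decidable _≈_
  x ≟ y = map′ to-injective to-cong (to x Fin.≟ to y)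

  nonzero-pigeonhole : (h : Fin (suc K) → Carrier) → (∀ i → h i ≉ 0#) →
                       ∃₂ λ i j → i Fin.< j × h i ≈ h j
  nonzero-pigeonhole h h≉0 =
    let i , j , i<j , eq = pigeonhole (ℕ.n<1+n K) (λ i → Fin.punchOut (to0≢ i))
    in  i , j , i<j , to-injective (punchOut-injective (to0≢ i) (to0≢ j) eq)
    where
    to0≢ : ∀ i → to 0# ≢ to (h i)
    to0≢ i eq = h≉0 i (to-injective (≡.sym eq))

  nonzero-covered : (f : Fin K → Carrier) → (∀ i → f i ≉ 0#) → (∀ i j → f i ≈ f j → i ≡ j) →
                    ∀ x → x ≉ 0# → ∃[ i ] x ≈ f i
  nonzero-covered f f≉0 f-injective x x≉0 with any? (λ i → x ≟ f i)
  ... | yes x∈f = x∈f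
  ... | no  x∉f = let i , j , i<j , hᵢ≈hⱼ = nonzero-pigeonhole h h≉0 in ⊥-elim (collision i j i<j hᵢ≈hⱼ)
    where
    h : Fin (suc K) → Carrier
    h zero    = x
    h (suc i) = f i
    h≉0 : ∀ i → h i ≉ 0#
    h≉0 zero    = x≉0
    h≉0 (suc i) = f≉0 i
    collision : ∀ i j → i Fin.< j → h i ≈ h j → ⊥
    collision zero    (suc j) _   x≈fⱼ = x∉f (j , x≈fⱼ)
    collision (suc i) (suc j) i<j fᵢ≈fⱼ with ≡.refl ← f-injective i j fᵢ≈fⱼ = ℕ.<-irrefl ≡.refl i<j

  ∃-period : ∀ {x} → x ≉ 0# → ∃[ D ] 0 ℕ.< D × D ℕ.≤ K × x ^ D ≈ 1#
  ∃-period {x} x≉0 =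
    let i , j , i<j , xⁱ≈xʲ = nonzero-pigeonhole (λ i → x ^ toℕ i) (λ i → ^-nonzero (toℕ i) x≉0)
    in  toℕ j ℕ.∸ toℕ i , ℕ.m<n⇒0<n∸m i<j , ℕ.≤-trans (ℕ.m∸n≤m (toℕ j) (toℕ i)) (ℕ.≤-pred (toℕ<n j)) ,
        *-cancelˡ-nonzero (^-nonzero (toℕ i) x≉0) (begin
          x ^ toℕ i * x ^ (toℕ j ℕ.∸ toℕ i) ≈⟨ ^-homo-* x (toℕ i) _ ⟨
          x ^ (toℕ i ℕ.+ (toℕ j ℕ.∸ toℕ i)) ≡⟨ ≡.cong (x ^_) (ℕ.m+[n∸m]≡n (ℕ.<⇒≤ i<j)) ⟩
          x ^ toℕ j                         ≈⟨ xⁱ≈xʲ ⟨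
          x ^ toℕ i                         ≈⟨ *-identityʳ _ ⟨
          x ^ toℕ i * 1#                    ∎)

  least-period : ∀ {x} D → x ^ suc D ≈ 1# → ∃[ d ] IsOrder x d × d ℕ.≤ suc D
  least-period {x} D xᴰ⁺¹≈1 = least (¬∀⟶∃¬-smallest (suc D) _ (λ i → ¬? (x ^ suc (toℕ i) ≟ 1#)) ¬∀)
    where
    ¬∀ : ¬ (∀ (i : Fin (suc D)) → x ^ suc (toℕ i) ≉ 1#)
    ¬∀ all = all (Fin.fromℕ D) (≡.subst (λ n → x ^ suc n ≈ 1#) (≡.sym (toℕ-fromℕ D)) xᴰ⁺¹≈1)
    least : (∃ λ i → ¬ (x ^ suc (toℕ i) ≉ 1#) × ((j : Fin.Fin′ i) → x ^ suc (toℕ (Fin.inject j)) ≉ 1#)) →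
            ∃[ d ] IsOrder x d × d ℕ.≤ suc D
    least (i , ¬xᵈ≉1 , below) = d , record { order>0 = ℕ.z<s ; ^order≈1 = xᵈ≈1 ; order∣ = d∣ } , toℕ<n i
      where
      d = suc (toℕ i)
      xᵈ≈1 : x ^ d ≈ 1#
      xᵈ≈1 = decidable-stable (x ^ d ≟ 1#) ¬xᵈ≉1
      d∣ : ∀ {k} → x ^ k ≈ 1# → d ∣ k
      d∣ {k} xᵏ≈1 with k % d in k%d≡
      ... | zero  = m%n≡0⇒n∣m k d k%d≡
      ... | suc r = contradiction (begin
        x ^ suc (toℕ (Fin.inject j)) ≡⟨ ≡.cong (λ n → x ^ suc n) (≡.trans (toℕ-inject j) (toℕ-fromℕ< r<i)) ⟩
        x ^ suc r                    ≡⟨ ≡.cong (x ^_) k%d≡ ⟨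
        x ^ (k % d)                  ≈⟨ ^-mod k xᵈ≈1 ⟨
        x ^ k                        ≈⟨ xᵏ≈1 ⟩
        1#                           ∎) (below j)
        where
        r<i : r ℕ.< toℕ i
        r<i = ℕ.s<s⁻¹ (≡.subst (ℕ._< d) k%d≡ (m%n<n k d))
        j : Fin.Fin′ i
        j = Fin.fromℕ< r<i

  order-exists : ∀ {x} → x ≉ 0# → ∃[ d ] IsOrder x d × d ℕ.≤ K
  order-exists {x} x≉0 = fromPeriod (∃-period x≉0)
    where
    fromPeriod : (∃[ D ] 0 ℕ.< D × D ℕ.≤ K × x ^ D ≈ 1#) → ∃[ d ] IsOrder x d × d ℕ.≤ K
    fromPeriod (suc D , _ , 1+D≤K , x¹⁺ᴰ≈1) =
      let d , o , d≤1+D = least-period D x¹⁺ᴰ≈1 in d , o , ℕ.≤-trans d≤1+D 1+D≤K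

  order≤K : ∀ {x d} → IsOrder x d → d ℕ.≤ K
  order≤K o = let d′ , o′ , d′≤K = order-exists (IsOrder⇒≉0 o) in ≡.subst (ℕ._≤ K) (IsOrder-unique o′ o) d′≤K

  -- 0 has no multiplicative order; orderOf gives it the junk value 0.
  orderOf : Carrier → ℕ
  orderOf x with x ≟ 0#
  ... | yes _   = 0
  ... | no  x≉0 = proj₁ (order-exists x≉0)

  orderOf-spec : ∀ x → (x ≈ 0# × orderOf x ≡ 0) ⊎ IsOrder x (orderOf x)
  orderOf-spec x with x ≟ 0#
  ... | yes x≈0 = inj₁ (x≈0 , ≡.refl)
  ... | no  x≉0 = inj₂ (proj₁ (proj₂ (order-exists x≉0)))

  IsOrder⇒orderOf : ∀ {x d} → IsOrder x d → orderOf x ≡ d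
  IsOrder⇒orderOf {x} o with orderOf-spec x
  ... | inj₁ (x≈0 , _) = contradiction x≈0 (IsOrder⇒≉0 o)
  ... | inj₂ o′        = IsOrder-unique o′ o

  K≤exponent : ∀ e → 0 ℕ.< e → (∀ y → y ≉ 0# → y ^ e ≈ 1#) → K ℕ.≤ e
  K≤exponent (suc e) _ y¹⁺ᵉ≈1 =
    ℕ.≤-pred (≡.subst (suc K ℕ.≤_) (≡.cong (λ n → suc (suc n)) (length-replicate e))
                      (monic-roots≤degree cs from root from-injective))
    where
    -- The factor y makes 0 a root as well: y (y ^ (1 + e) - 1) vanishes on all of F and has degree 2 + e.
    cs : List Carrier
    cs = 0# ∷ - 1# ∷ replicate e 0#
    root : ∀ i → evalMonic cs (from i) ≈ 0#
    root i with from i ≟ 0#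
    ... | yes y≈0 = trans (+-identityˡ _) (trans (*-congʳ y≈0) (zeroˡ _))
    ... | no  y≉0 = trans (+-identityˡ _) (trans (*-congˡ (begin
      - 1# + from i * evalMonic (replicate e 0#) (from i) ≈⟨ +-congˡ (*-congˡ (evalMonic-replicate e (from i))) ⟩
      - 1# + from i ^ suc e                              ≈⟨ +-congˡ (y¹⁺ᵉ≈1 (from i) y≉0) ⟩
      - 1# + 1#                                          ≈⟨ -‿inverseˡ 1# ⟩
      0#                                                 ∎)) (zeroʳ _))
    from-injective : ∀ i j → from i ≈ from j → i ≡ j
    from-injective i j fromᵢ≈fromⱼ =
      ≡.trans (≡.sym (strictlyInverseˡ i)) (≡.trans (to-cong fromᵢ≈fromⱼ) (strictlyInverseˡ j))

  maximalOrder⇒IsOrder-K : ∀ {g e} → IsOrder g e → (∀ {x d} → IsOrder x d → d ℕ.≤ e) → IsOrder g K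
  maximalOrder⇒IsOrder-K {g} {e} og maximal = ≡.subst (IsOrder g) (ℕ.≤-antisym (order≤K og) K≤e) og
    where
    K≤e : K ℕ.≤ e
    K≤e = K≤exponent e (order>0 og) λ y y≉0 →
      let d , oy , _ = order-exists y≉0 in ∣⇒^≈1 y d (^order≈1 oy) (order∣maxOrder og maximal oy)

  primitiveRoot : ∃[ g ] IsOrder g K
  primitiveRoot = let i₀ , ≤max = ∃-argmax (orderOf ∘ from) in
                  fromMaximal (from i₀) (bounds-all ≤max) (orderOf-spec (from i₀))
    where
    bounds-all : ∀ {e} → (∀ i → orderOf (from i) ℕ.≤ e) → ∀ {x d} → IsOrder x d → d ℕ.≤ e
    bounds-all ≤e {x} o = ≡.subst (ℕ._≤ _) (IsOrder⇒orderOf (IsOrder-cong (sym (strictlyInverseʳ x)) o)) (≤e (to x))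
    fromMaximal : ∀ g → (∀ {x d} → IsOrder x d → d ℕ.≤ orderOf g) →
                  (g ≈ 0# × orderOf g ≡ 0) ⊎ IsOrder g (orderOf g) → ∃[ g ] IsOrder g K
    fromMaximal g maximal (inj₁ (_ , e≡0)) = contradiction (≡.subst (1 ℕ.≤_) e≡0 (maximal IsOrder-1)) λ ()
    fromMaximal g maximal (inj₂ og)        = g , maximalOrder⇒IsOrder-K og maximal

module HeffterConstruction {c ℓ} (F : CommutativeRing c ℓ) (isField : IsField F)
  {m′ n′ p p′ : ℕ} (pp : Prime p) (pp′ : Prime p′) (p≢2 : p ≢ 2) (p′≢2 : p′ ≢ 2) (p≢p′ : p ≢ p′)
  (card : Inverse (CommutativeRing.setoid F) (≡.setoid (Fin (suc (2 ℕ.* (m′ ℕ.* p) ℕ.* (n′ ℕ.* p′))))))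
  where

  open CommutativeRing F hiding (zero)
  open import Algebra.Properties.CommutativeSemiring.Exp commutativeSemiring
  open import Algebra.Properties.Ring ring using (-‿distribʳ-*)
  open import Algebra.Properties.Semiring.Sum semiring using (sum; *-distribˡ-sum; *-distribʳ-sum)
  open import Data.Nat.Solver using (module +-*-Solver)
  open import Data.Fin using (remQuot; quotient; remainder)
  open import Data.Fin.Properties using (toℕ<n; toℕ-injective)
  open import Relation.Binary.Reasoning.Setoid setoid
  open FieldProperties F isField
  open FiniteField F isField (2 ℕ.* (m′ ℕ.* p) ℕ.* (n′ ℕ.* p′)) card
  open MultiplicativeOrder commutativeSemiring
  open IsOrder

  m n T mn K : ℕ
  m  = m′ ℕ.* p
  n  = n′ ℕ.* p′
  T  = m′ ℕ.* n′
  mn = m ℕ.* n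
  K  = 2 ℕ.* m ℕ.* n

  g : Carrier
  g = proj₁ primitiveRoot

  g-order : IsOrder g K
  g-order = proj₂ primitiveRoot

  a k : Fin m → ℕ
  a r = toℕ (quotient {m′} p r)
  k r = toℕ (remainder {m′} p r)
  b l : Fin n → ℕ
  b s = toℕ (quotient {n′} p′ s)
  l s = toℕ (remainder {n′} p′ s)

  α β : Carrier
  α = g ^ (T ℕ.* (2 ℕ.* p′))
  β = g ^ (T ℕ.* (2 ℕ.* p))

  u : Fin m → Carrier
  u r = g ^ a r * α ^ k r

  v : Fin n → Carrier
  v s = (g ^ m′) ^ b s * β ^ l s

  A : Matrix F m n
  A r s = u r * v s

  α-order : IsOrder α p
  α-order = IsOrder-^ (T ℕ.* (2 ℕ.* p′)) (≡.subst (IsOrder g) K≡ g-order)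
    where
    open +-*-Solver
    K≡ : K ≡ T ℕ.* (2 ℕ.* p′) ℕ.* p
    K≡ = solve 4 (λ m′ n′ p p′ → con 2 :* (m′ :* p) :* (n′ :* p′) := m′ :* n′ :* (con 2 :* p′) :* p) ≡.refl m′ n′ p p′

  β-order : IsOrder β p′
  β-order = IsOrder-^ (T ℕ.* (2 ℕ.* p)) (≡.subst (IsOrder g) K≡ g-order)
    where
    open +-*-Solver
    K≡ : K ≡ T ℕ.* (2 ℕ.* p) ℕ.* p′
    K≡ = solve 4 (λ m′ n′ p p′ → con 2 :* (m′ :* p) :* (n′ :* p′) := m′ :* n′ :* (con 2 :* p) :* p′) ≡.refl m′ n′ p p′

  row-sum : ∀ r → ∑ F n (A r) ≈ 0#
  row-sum r = begin
    ∑ F n (A r)  ≡⟨ ∑≡sum n (A r) ⟩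
    sum (A r)    ≈⟨ *-distribˡ-sum (u r) v ⟨
    u r * sum v  ≈⟨ *-congˡ (sum-blocks≈0 {n′} {p′} (λ b → (g ^ m′) ^ toℕ b)
                                         (^order≈1 β-order) (IsOrder⇒≉1 β-order (prime⇒2≤ pp′))) ⟩
    u r * 0#     ≈⟨ zeroʳ (u r) ⟩
    0#           ∎

  column-sum : ∀ s → ∑ F m (λ r → A r s) ≈ 0#
  column-sum s = begin
    ∑ F m (λ r → A r s)  ≡⟨ ∑≡sum m (λ r → A r s) ⟩
    sum (λ r → A r s)    ≈⟨ *-distribʳ-sum (v s) u ⟨
    sum u * v s          ≈⟨ *-congʳ (sum-blocks≈0 {m′} {p} (λ a → g ^ toℕ a)
                                                 (^order≈1 α-order) (IsOrder⇒≉1 α-order (prime⇒2≤ pp))) ⟩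
    0# * v s             ≈⟨ zeroˡ (v s) ⟩
    0#                   ∎

  exponent : Fin m → Fin n → ℕ
  exponent r s = a r ℕ.+ m′ ℕ.* b s ℕ.+ T ℕ.* (2 ℕ.* p′ ℕ.* k r ℕ.+ 2 ℕ.* p ℕ.* l s)

  A≈g^exponent : ∀ r s → A r s ≈ g ^ exponent r s
  A≈g^exponent r s = begin
    (g ^ a r * α ^ k r) * ((g ^ m′) ^ b s * β ^ l s)
      ≈⟨ *-cong (*-congˡ (^-assocʳ g X (k r))) (*-cong (^-assocʳ g m′ (b s)) (^-assocʳ g Y (l s))) ⟩
    (g ^ a r * g ^ (X ℕ.* k r)) * (g ^ (m′ ℕ.* b s) * g ^ (Y ℕ.* l s))
      ≈⟨ *-cong (^-homo-* g (a r) (X ℕ.* k r)) (^-homo-* g (m′ ℕ.* b s) (Y ℕ.* l s)) ⟨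
    g ^ (a r ℕ.+ X ℕ.* k r) * g ^ (m′ ℕ.* b s ℕ.+ Y ℕ.* l s)
      ≈⟨ ^-homo-* g (a r ℕ.+ X ℕ.* k r) (m′ ℕ.* b s ℕ.+ Y ℕ.* l s) ⟨
    g ^ (a r ℕ.+ X ℕ.* k r ℕ.+ (m′ ℕ.* b s ℕ.+ Y ℕ.* l s))
      ≡⟨ ≡.cong (g ^_) (solve 8 (λ a b k l m′ n′ p p′ →
           a :+ m′ :* n′ :* (con 2 :* p′) :* k :+ (m′ :* b :+ m′ :* n′ :* (con 2 :* p) :* l)
           := a :+ m′ :* b :+ m′ :* n′ :* (con 2 :* p′ :* k :+ con 2 :* p :* l))
           ≡.refl (a r) (b s) (k r) (l s) m′ n′ p p′) ⟩
    g ^ exponent r s ∎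
    where
    open +-*-Solver
    X = T ℕ.* (2 ℕ.* p′)
    Y = T ℕ.* (2 ℕ.* p)

  highDigits : Fin m → Fin n → ℕ → ℕ
  highDigits r s X = 2 ℕ.* p′ ℕ.* k r ℕ.+ 2 ℕ.* p ℕ.* l s ℕ.+ p ℕ.* p′ ℕ.* X

  exponent+multiple : ∀ r s X →
                      exponent r s ℕ.+ X ℕ.* mn ≡ a r ℕ.+ m′ ℕ.* b s ℕ.+ m′ ℕ.* n′ ℕ.* highDigits r s X
  exponent+multiple r s X = solve 9 (λ a b k l X m′ n′ p p′ →
    a :+ m′ :* b :+ m′ :* n′ :* (con 2 :* p′ :* k :+ con 2 :* p :* l) :+ X :* (m′ :* p :* (n′ :* p′))
    := a :+ m′ :* b :+ m′ :* n′ :* (con 2 :* p′ :* k :+ con 2 :* p :* l :+ p :* p′ :* X))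
    ≡.refl (a r) (b s) (k r) (l s) X m′ n′ p p′
    where open +-*-Solver

  exponent-injective : ∀ {r r′ s s′ X Y} → exponent r s ℕ.+ X ℕ.* mn ≡ exponent r′ s′ ℕ.+ Y ℕ.* mn →
                       r ≡ r′ × s ≡ s′ × X ≡ Y
  exponent-injective {r} {r′} {s} {s′} {X} {Y} eq =
    remQuot-injective p (≡.cong₂ _,_ (toℕ-injective a≡) (toℕ-injective k≡)) ,
    remQuot-injective p′ (≡.cong₂ _,_ (toℕ-injective b≡) (toℕ-injective l≡)) ,
    X≡Y
    where
    digits = mixedRadix-unique {m′} {n′} {a r} {a r′} {b s} {b s′} {highDigits r s X} {highDigits r′ s′ Y}
               (toℕ<n (quotient {m′} p r)) (toℕ<n (quotient {m′} p r′))
               (toℕ<n (quotient {n′} p′ s)) (toℕ<n (quotient {n′} p′ s′))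
               (≡.trans (≡.sym (exponent+multiple r s X)) (≡.trans eq (exponent+multiple r′ s′ Y)))
    a≡ = proj₁ digits
    b≡ = proj₁ (proj₂ digits)
    high = crt-digits {p} {p′} {k r} {k r′} {l s} {l s′} {X} {Y} pp pp′ p≢2 p′≢2 p≢p′
             (toℕ<n (remainder {m′} p r)) (toℕ<n (remainder {m′} p r′))
             (toℕ<n (remainder {n′} p′ s)) (toℕ<n (remainder {n′} p′ s′)) (proj₂ (proj₂ digits))
    k≡ = proj₁ high
    l≡ = proj₁ (proj₂ high)
    X≡Y = proj₂ (proj₂ high)

  signedEntry : Fin 2 × Fin m × Fin n → Carrier
  signedEntry (zero  , r , s) = A r s
  signedEntry (suc _ , r , s) = - A r s

  signedExponent : Fin 2 × Fin m × Fin n → ℕ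
  signedExponent (σ , r , s) = exponent r s ℕ.+ toℕ σ ℕ.* mn

  signedEntry≈g^ : ∀ i → signedEntry i ≈ g ^ signedExponent i
  signedEntry≈g^ (zero , r , s) = begin
    A r s                    ≈⟨ A≈g^exponent r s ⟩
    g ^ exponent r s         ≡⟨ ≡.cong (g ^_) (ℕ.+-identityʳ (exponent r s)) ⟨
    g ^ (exponent r s ℕ.+ 0) ∎
  signedEntry≈g^ (suc zero , r , s) = begin
    - A r s                         ≈⟨ -‿cong (trans (A≈g^exponent r s) (sym (*-identityʳ _))) ⟩
    - (g ^ exponent r s * 1#)       ≈⟨ -‿distribʳ-* (g ^ exponent r s) 1# ⟩
    g ^ exponent r s * - 1#         ≈⟨ *-congˡ (^half≈-1 {g} {mn} (≡.subst (IsOrder g) (ℕ.*-assoc 2 m n) g-order)) ⟨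
    g ^ exponent r s * g ^ mn       ≈⟨ ^-homo-* g (exponent r s) mn ⟨
    g ^ (exponent r s ℕ.+ mn)       ≡⟨ ≡.cong (λ x → g ^ (exponent r s ℕ.+ x)) (ℕ.*-identityˡ mn) ⟨
    g ^ (exponent r s ℕ.+ 1 ℕ.* mn) ∎

  signedEntry≉0 : ∀ i → signedEntry i ≉ 0#
  signedEntry≉0 i = ^-nonzero (signedExponent i) (IsOrder⇒≉0 g-order) ∘ trans (sym (signedEntry≈g^ i))

  sign+multiple : ∀ (σ : Fin 2) r s X →
                  exponent r s ℕ.+ toℕ σ ℕ.* mn ℕ.+ X ℕ.* K ≡ exponent r s ℕ.+ (toℕ σ ℕ.+ 2 ℕ.* X) ℕ.* mn
  sign+multiple σ r s X = solve 5 (λ e σ X m n → e :+ σ :* (m :* n) :+ X :* (con 2 :* m :* n)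
                                                := e :+ (σ :+ con 2 :* X) :* (m :* n))
                                  ≡.refl (exponent r s) (toℕ σ) X m n
    where open +-*-Solver

  signedExponent-injective : ∀ i j {X Y} → signedExponent i ℕ.+ X ℕ.* K ≡ signedExponent j ℕ.+ Y ℕ.* K → i ≡ j
  signedExponent-injective (σ , r , s) (σ′ , r′ , s′) {X} {Y} eq =
    ≡.cong₂ _,_ (toℕ-injective (proj₁ σ≡σ′)) (≡.cong₂ _,_ (proj₁ indices) (proj₁ (proj₂ indices)))
    where
    indices : r ≡ r′ × s ≡ s′ × toℕ σ ℕ.+ 2 ℕ.* X ≡ toℕ σ′ ℕ.+ 2 ℕ.* Y
    indices = exponent-injective {r} {r′} {s} {s′} {toℕ σ ℕ.+ 2 ℕ.* X} {toℕ σ′ ℕ.+ 2 ℕ.* Y}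
                (≡.trans (≡.sym (sign+multiple σ r s X)) (≡.trans eq (sign+multiple σ′ r′ s′ Y)))
    σ≡σ′ : toℕ σ ≡ toℕ σ′ × X ≡ Y
    σ≡σ′ = divMod-unique (toℕ<n σ) (toℕ<n σ′) (proj₂ (proj₂ indices))

  signedEntry-injective : ∀ i j → signedEntry i ≈ signedEntry j → i ≡ j
  signedEntry-injective i j eq =
    let X , Y , eq′ = ^-injective-mod {g} {K} {signedExponent i} {signedExponent j} g-order
                        (trans (sym (signedEntry≈g^ i)) (trans eq (signedEntry≈g^ j)))
    in  signedExponent-injective i j {X} {Y} eq′

  decode : Fin K → Fin 2 × Fin m × Fin n
  decode t = let σr , s = remQuot {2 ℕ.* m} n t ; σ , r = remQuot {2} m σr in σ , r , s

  decode-injective : ∀ {t t′} → decode t ≡ decode t′ → t ≡ t′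
  decode-injective eq = remQuot-injective n (≡.cong₂ _,_
    (remQuot-injective m (≡.cong₂ _,_ (≡.cong proj₁ eq) (≡.cong (proj₁ ∘ proj₂) eq)))
    (≡.cong (proj₂ ∘ proj₂) eq))

  entries-cover : ∀ x → x ≉ 0# → ∃₂ λ r s → x ≈ A r s ⊎ x ≈ - A r s
  entries-cover x x≉0 =
    let t , x≈ = nonzero-covered (signedEntry ∘ decode) (signedEntry≉0 ∘ decode)
                   (λ t t′ → decode-injective ∘ signedEntry-injective (decode t) (decode t′)) x x≉0
    in  unsign (decode t) x≈
    where
    unsign : ∀ i → x ≈ signedEntry i → ∃₂ λ r s → x ≈ A r s ⊎ x ≈ - A r s
    unsign (zero  , r , s) x≈A  = r , s , inj₁ x≈A
    unsign (suc _ , r , s) x≈-A = r , s , inj₂ x≈-A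

  entries-injective : ∀ r s r′ s′ → A r s ≈ A r′ s′ → r ≡ r′ × s ≡ s′
  entries-injective r s r′ s′ eq =
    let indices≡ = signedEntry-injective (zero , r , s) (zero , r′ , s′) eq
    in  ≡.cong (proj₁ ∘ proj₂) indices≡ , ≡.cong (proj₂ ∘ proj₂) indices≡

  A≉0 : ∀ r s → A r s ≉ 0#
  A≉0 r s = signedEntry≉0 (zero , r , s)

  A-isHeffter : IsHeffter F A
  A-isHeffter = (entries-injective , A≉0 , entries-cover) , row-sum , column-sum

open import Level using (Level)
open import Data.Nat using (ℕ; _≤_; _*_; _+_)
open import Data.Nat.Divisibility using (_∣_; divides)
open import Data.Product using (Σ; _×_)
open import Relation.Nullary using (¬_)
open import Relation.Binary.PropositionalEquality using (_≡_; refl)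

theorem2 : {c ℓ : Level} (m n : ℕ) → 3 ≤ m → 3 ≤ n
    → IsPrimePower (2 * m * n + 1)
    → (p p′ : ℕ) → Prime p → Prime p′ → ¬ (p ≡ 2) → ¬ (p′ ≡ 2) → ¬ (p ≡ p′)
    → p ∣ m → p′ ∣ n
    → (F : CommutativeRing c ℓ) → IsFiniteFieldOfOrder F (2 * m * n + 1)
    → Σ (Matrix F m n) λ A → IsHeffter F A × RankOne F A
theorem2 m n 3≤m 3≤n _ p p′ pp pp′ p≢2 p′≢2 p≢p′ (divides m′ refl) (divides n′ refl) F finite =
  A , A-isHeffter , (fromℕ< (ℕ.<-≤-trans ℕ.z<s 3≤m) , fromℕ< (ℕ.<-≤-trans ℕ.z<s 3≤n) , A≉0 _ _) ,
  u , v , λ _ _ → CommutativeRing.refl F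
  where
  open IsFiniteFieldOfOrder finite
  card : Inverse (CommutativeRing.setoid F) (≡.setoid (Fin (suc (2 * m * n))))
  card = ≡.subst (λ q → Inverse (CommutativeRing.setoid F) (≡.setoid (Fin q))) (ℕ.+-comm _ 1) cardinality
  open HeffterConstruction F isField {m′} {n′} pp pp′ p≢2 p′≢2 p≢p′ card using (A; A-isHeffter; A≉0; u; v)
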